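{- Let $G$ be a minimal counterexample. Then no component of $B=\overline{G}$ is a $5$-cycle.
   Context: A minimal counterexample is a simple graph $G$ of order $n\ge 5$ with at least $\binom{n}{2}-n+5$ edges that has no orientation of diameter two, chosen of minimum order among all such graphs and, subject to that, of minimum size. $\overline{G}$ is the complement of $G$. -}

module Defs where

open import Data.Nat using (ℕ; _+_; _*_; _≤_; _<_)
open import Data.Nat.Combinatorics using (_C_)
open import Data.Bool using (Bool; true; false; not; _∧_; if_then_else_)
open import Data.Fin using (Fin; toℕ; _≟_)
open import Data.List using (List; map; allFin)
open import Data.Nat.ListAction using (sum)
open import Data.Product using (Σ; ∃; _×_; _,_)
open import Data.Sum using (_⊎_)
open import Relation.Nullary using (¬_; ⌊_⌋)
open import Relation.Binary.PropositionalEquality using (_≡_; _≢_)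

record Graph (n : ℕ) : Set where
  field
    adj    : Fin n → Fin n → Bool
    adj-sym    : ∀ u v → adj u v ≡ adj v u
    adj-irrefl : ∀ u → adj u u ≡ false
open Graph public

edgeCount : ∀ {n} → Graph n → ℕ
edgeCount {n} G =
  sum (map (λ i → sum (map (λ j → if (toℕ i Data.Nat.<ᵇ toℕ j) ∧ adj G i j then 1 else 0)
                           (allFin n)))
           (allFin n))
  where import Data.Nat

-- Edge condition |E(G)| ≥ C(n,2) - n + 5, written without truncated subtraction.
ManyEdges : ∀ {n} → Graph n → Set
ManyEdges {n} G = (n C 2) + 5 ≤ edgeCount G + n

complement : ∀ {n} → Graph n → Graph n
complement {n} G = record
  { adj    = λ u v → not (adj G u v) ∧ not ⌊ u ≟ v ⌋
  ; adj-sym    = symC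
  ; adj-irrefl = irrC
  }
  where
  open import Relation.Binary.PropositionalEquality using (refl; cong; cong₂; sym; trans)
  open import Relation.Nullary using (yes; no)
  open import Data.Bool.Properties using (∧-zeroʳ)
  symC : ∀ u v → (not (adj G u v) ∧ not ⌊ u ≟ v ⌋) ≡ (not (adj G v u) ∧ not ⌊ v ≟ u ⌋)
  symC u v with u ≟ v | v ≟ u
  ... | yes _ | yes _ = trans (∧-zeroʳ _) (sym (∧-zeroʳ _))
  ... | yes refl | no ¬p = Data.Empty.⊥-elim (¬p refl)
    where import Data.Empty
  ... | no ¬p | yes refl = Data.Empty.⊥-elim (¬p refl)
    where import Data.Empty
  ... | no _ | no _ = cong₂ _∧_ (cong not (adj-sym G u v)) refl
  irrC : ∀ u → (not (adj G u u) ∧ not ⌊ u ≟ u ⌋) ≡ false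
  irrC u with u ≟ u
  ... | yes _ = ∧-zeroʳ _
  ... | no ¬p = Data.Empty.⊥-elim (¬p refl)
    where import Data.Empty

IsOrientation : ∀ {n} → Graph n → (Fin n → Fin n → Bool) → Set
IsOrientation {n} G D =
  (∀ u v → D u v ≡ true → adj G u v ≡ true) ×
  (∀ u v → adj G u v ≡ true → D u v ≡ true ⊎ D v u ≡ true) ×
  (∀ u v → D u v ≡ true → D v u ≡ false)

DiameterTwo : ∀ {n} → (Fin n → Fin n → Bool) → Set
DiameterTwo {n} D =
  ∀ u v → u ≢ v → D u v ≡ true ⊎ Σ (Fin n) (λ w → D u w ≡ true × D w v ≡ true)

HasDiam2Orientation : ∀ {n} → Graph n → Set
HasDiam2Orientation G = Σ _ (λ D → IsOrientation G D × DiameterTwo D)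

Counterexample : ∀ {n} → Graph n → Set
Counterexample {n} G = 5 ≤ n × ManyEdges G × ¬ HasDiam2Orientation G

MinimalCounterexample : ∀ {n} → Graph n → Set
MinimalCounterexample {n} G =
  Counterexample G ×
  (∀ m → m < n → (H : Graph m) → ¬ Counterexample H) ×
  (∀ (H : Graph n) → edgeCount H < edgeCount G → ¬ Counterexample H)

c5adj : Fin 5 → Fin 5 → Bool
c5adj i j = ((toℕ i + 1) Data.Nat.% 5 Data.Nat.≡ᵇ toℕ j) Data.Bool.∨ ((toℕ j + 1) Data.Nat.% 5 Data.Nat.≡ᵇ toℕ i)
  where import Data.Nat
        import Data.Bool

HasC5Component : ∀ {n} → Graph n → Set
HasC5Component {n} B =
  Σ (Fin 5 → Fin n) λ f →
    (∀ i j → f i ≡ f j → i ≡ j) ×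
    (∀ i j → adj B (f i) (f j) ≡ c5adj i j) ×
    (∀ i v → (∀ j → v ≢ f j) → adj B (f i) v ≡ false)

-- Suppose the complement of a minimal counterexample G has a 5-cycle component C. Then G is
-- the join of the pentagram (the complement of C₅) with the graph H induced on the other
-- m = n - 5 vertices. Deleting C loses exactly the five non-edges of C, so H again satisfies
-- the edge bound and m ≥ 5; by minimality of the order, H has an orientation of diameter two.
-- It extends to G: orient the pentagram as 0→2, 0→3, 3→1, 1→4, 2→4, fix a vertex x of H,
-- split the vertices of H into x, its out-neighbours A and the rest Z, and orient all edges
-- between a cycle vertex and one of these classes the same way. A short case analysis shows
-- that any two vertices are then joined by a directed path of length at most two, so G was
-- not a counterexample after all.

module Submission where

open import Defs
open import Data.Nat using (ℕ; zero; suc; _+_; _*_; _≤_; _<_; s≤s; z≤n; _<ᵇ_; _≡ᵇ_; _%_)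
open import Data.Nat.Properties
  using ( +-0-commutativeMonoid; +-identityʳ; +-assoc; +-cancelˡ-≤; +-monoʳ-≤; *-cancelˡ-≡
        ; *-distribˡ-+; ≤-trans; ≤-antisym; <-irrefl; <⇒≯; ≮⇒≥; m≤n+m; m<n+m; <ᵇ-reflects-<)
open import Data.Nat.Combinatorics using (_C_; nC1≡n; nCk+nC[k+1]≡[n+1]C[k+1])
open import Data.Nat.ListAction using (sum)
open import Data.Bool using (Bool; true; false; not; _∧_; if_then_else_) renaming (_≟_ to _≟ᵇ_)
open import Data.Bool.Properties using (not-involutive; ∧-zeroʳ; ∨-comm)
open import Data.Fin using (Fin; zero; suc; toℕ; _≟_; _↑ˡ_; _↑ʳ_; splitAt; punchOut; punchIn)
open import Data.Fin.Patterns using (0F; 1F; 2F; 3F; 4F)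
open import Data.Fin.Properties
  using ( toℕ-injective; suc-injective; 0≢1+n; all?; +↔⊎; splitAt-↑ˡ; splitAt-↑ʳ
        ; punchOut-injective; punchIn-punchOut)
open import Data.Fin.Permutation as Perm using (Permutation; _⟨$⟩ʳ_; insert-punchIn; ↔⇒≡)
open import Data.List using (map; allFin; tabulate)
open import Data.List.Properties using (map-tabulate)
open import Data.Sum using (_⊎_; inj₁; inj₂)
open import Data.Sum.Properties using (inj₂-injective)
open import Data.Product using (∃-syntax; Σ-syntax; _×_; _,_; proj₁; proj₂)
open import Function using (_∘_; id; _⇔_; mk⇔)
open import Function.Bundles using (_↔_; Inverse; Injection; Equivalence)
open import Function.Construct.Composition using (_↔-∘_)
open import Function.Construct.Symmetry using (↔-sym)
open import Function.Definitions using (Injective)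
open import Function.Properties.Inverse using (↔⇒↣)
open import Relation.Nullary using (¬_; Dec; ⌊_⌋; yes; no; contradiction)
open import Relation.Nullary.Decidable using (from-yes; _×-dec_; _⊎-dec_; _→-dec_)
open import Relation.Nullary.Reflects using (ofʸ; ofⁿ)
open import Relation.Binary.PropositionalEquality
open import Algebra.Properties.CommutativeMonoid.Sum +-0-commutativeMonoid
  using (sum-syntax; ∑-distrib-+; ∑-comm; ∑-permute; sum-cong-≗; sum-replicate-zero)

open Inverse using (to; from)

-- Spelled as in edgeCount, so that edgeCount unfolds to a double sum of 𝟙.
𝟙 : Bool → ℕ
𝟙 b = if b then 1 else 0

∑-one : ∀ n → ∑[ i < n ] 1 ≡ n
∑-one zero    = refl
∑-one (suc n) = cong suc (∑-one n)

∑∑-cong : ∀ {m n} {h k : Fin m → Fin n → ℕ} → (∀ i j → h i j ≡ k i j) →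
          ∑[ i < m ] ∑[ j < n ] h i j ≡ ∑[ i < m ] ∑[ j < n ] k i j
∑∑-cong h≗k = sum-cong-≗ (λ i → sum-cong-≗ (h≗k i))

∑∑-distrib-+ : ∀ {m n} (h k : Fin m → Fin n → ℕ) →
  ∑[ i < m ] ∑[ j < n ] (h i j + k i j) ≡ ∑[ i < m ] ∑[ j < n ] h i j + ∑[ i < m ] ∑[ j < n ] k i j
∑∑-distrib-+ {m} h k = trans (sum-cong-≗ (λ i → ∑-distrib-+ (h i) (k i))) (∑-distrib-+ {m} _ _)

sum-map-allFin : ∀ {n} (h : Fin n → ℕ) → sum (map h (allFin n)) ≡ ∑[ i < n ] h i
sum-map-allFin h = trans (cong sum (map-tabulate id h)) (sum-tabulate h)
  where
  sum-tabulate : ∀ {n} (h : Fin n → ℕ) → sum (tabulate h) ≡ ∑[ i < n ] h i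
  sum-tabulate {zero}  h = refl
  sum-tabulate {suc n} h = cong (h zero +_) (sum-tabulate (h ∘ suc))

∑-zero : ∀ {n} {h : Fin n → ℕ} → (∀ i → h i ≡ 0) → ∑[ i < n ] h i ≡ 0
∑-zero {n} h≡0 = trans (sum-cong-≗ h≡0) (sum-replicate-zero n)

∑-↑ : ∀ k {m} (h : Fin (k + m) → ℕ) → ∑[ u < k + m ] h u ≡ ∑[ i < k ] h (i ↑ˡ m) + ∑[ j < m ] h (k ↑ʳ j)
∑-↑ zero    h = refl
∑-↑ (suc k) h = trans (cong (h zero +_) (∑-↑ k (h ∘ suc))) (sym (+-assoc (h zero) _ _))

∑-↔⊎ : ∀ {k m n} (e : (Fin k ⊎ Fin m) ↔ Fin n) (h : Fin n → ℕ) →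
  ∑[ v < n ] h v ≡ ∑[ i < k ] h (to e (inj₁ i)) + ∑[ j < m ] h (to e (inj₂ j))
∑-↔⊎ {k} {m} {n} e h = begin
  ∑[ v < n ] h v                                          ≡⟨ ∑-permute h (e ↔-∘ +↔⊎) ⟩
  ∑[ u < k + m ] h (to e (splitAt k u))                   ≡⟨ ∑-↑ k _ ⟩
  ∑[ i < k ] h (to e (splitAt k (i ↑ˡ m))) + ∑[ j < m ] h (to e (splitAt k (k ↑ʳ j)))
    ≡⟨ cong₂ _+_ (sum-cong-≗ (cong (h ∘ to e) ∘ λ i → splitAt-↑ˡ k i m))
                 (sum-cong-≗ (cong (h ∘ to e) ∘ splitAt-↑ʳ k m)) ⟩
  ∑[ i < k ] h (to e (inj₁ i)) + ∑[ j < m ] h (to e (inj₂ j)) ∎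
  where open ≡-Reasoning

-- Completing an injection to a bijection

extend-injection : ∀ {k n} (f : Fin k → Fin n) → Injective _≡_ _≡_ f →
  ∃[ m ] Σ[ π ∈ Permutation (k + m) n ] ∀ i → π ⟨$⟩ʳ (i ↑ˡ m) ≡ f i
extend-injection {zero}  {n}     f _ = n , Perm.id , λ ()
extend-injection {suc k} {zero}  f _ with f zero
... | ()
extend-injection {suc k} {suc n} f f-inj = m , Perm.insert zero (f zero) π , π-extends
  where
  f₀≢ : ∀ i → f zero ≢ f (suc i)
  f₀≢ i = 0≢1+n ∘ f-inj

  f′ : Fin k → Fin n
  f′ i = punchOut (f₀≢ i)

  f′-inj : Injective _≡_ _≡_ f′
  f′-inj {i} {j} eq = suc-injective (f-inj (punchOut-injective (f₀≢ i) (f₀≢ j) eq))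

  m : ℕ
  m = proj₁ (extend-injection f′ f′-inj)

  π : Permutation (k + m) n
  π = proj₁ (proj₂ (extend-injection f′ f′-inj))

  π-extends-f′ : ∀ i → π ⟨$⟩ʳ (i ↑ˡ m) ≡ f′ i
  π-extends-f′ = proj₂ (proj₂ (extend-injection f′ f′-inj))

  π-extends : ∀ i → Perm.insert zero (f zero) π ⟨$⟩ʳ (i ↑ˡ m) ≡ f i
  π-extends zero    = refl
  π-extends (suc i) = begin
    Perm.insert zero (f zero) π ⟨$⟩ʳ punchIn zero (i ↑ˡ m) ≡⟨ insert-punchIn zero (f zero) π (i ↑ˡ m) ⟩
    punchIn (f zero) (π ⟨$⟩ʳ (i ↑ˡ m))                    ≡⟨ cong (punchIn (f zero)) (π-extends-f′ i) ⟩
    punchIn (f zero) (f′ i)                                ≡⟨ punchIn-punchOut (f₀≢ i) ⟩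
    f (suc i)                                              ∎
    where open ≡-Reasoning

extend-injection-⊎ : ∀ {k n} (f : Fin k → Fin n) → Injective _≡_ _≡_ f →
  ∃[ m ] Σ[ e ∈ (Fin k ⊎ Fin m) ↔ Fin n ] ∀ i → to e (inj₁ i) ≡ f i
extend-injection-⊎ f f-inj with extend-injection f f-inj
... | m , π , π-extends = m , π ↔-∘ ↔-sym +↔⊎ , π-extends

pullback : ∀ {k n} → Graph n → (Fin k → Fin n) → Graph k
pullback G f = record
  { adj        = λ i j → adj G (f i) (f j)
  ; adj-sym    = λ i j → adj-sym G (f i) (f j)
  ; adj-irrefl = adj-irrefl G ∘ f
  }

≟-injective : ∀ {k n} {f : Fin k → Fin n} → Injective _≡_ _≡_ f → ∀ i j → ⌊ f i ≟ f j ⌋ ≡ ⌊ i ≟ j ⌋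
≟-injective {f = f} f-inj i j with f i ≟ f j | i ≟ j
... | yes _       | yes _ = refl
... | no _        | no _  = refl
... | yes fi≡fj   | no i≢j = contradiction (f-inj fi≡fj) i≢j
... | no fi≢fj    | yes refl = contradiction refl fi≢fj

complement-pullback : ∀ {k n} (G : Graph n) {f : Fin k → Fin n} → Injective _≡_ _≡_ f →
  ∀ i j → adj (complement (pullback G f)) i j ≡ adj (complement G) (f i) (f j)
complement-pullback G {f} f-inj i j =
  cong (λ b → not (adj G (f i) (f j)) ∧ not b) (sym (≟-injective f-inj i j))

complement-involutive : ∀ {n} (G : Graph n) i j → adj (complement (complement G)) i j ≡ adj G i j
complement-involutive G i j with i ≟ j
... | yes refl = trans (∧-zeroʳ _) (sym (adj-irrefl G i))
... | no _ with adj G i j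
...   | true  = refl
...   | false = refl

C₅ : Graph 5
C₅ = record
  { adj        = c5adj
  ; adj-sym    = λ i j → ∨-comm (succeeds i j) (succeeds j i)
  ; adj-irrefl = λ { 0F → refl ; 1F → refl ; 2F → refl ; 3F → refl ; 4F → refl }
  }
  where
  succeeds : Fin 5 → Fin 5 → Bool
  succeeds i j = (toℕ i + 1) % 5 ≡ᵇ toℕ j

-- Counting edges

_<ᶠ_ : ∀ {n} → Fin n → Fin n → Bool
i <ᶠ j = toℕ i <ᵇ toℕ j

arcCount : ∀ {n} → Graph n → ℕ
arcCount {n} G = ∑[ i < n ] ∑[ j < n ] 𝟙 (adj G i j)

edgeCount≡∑ : ∀ {n} (G : Graph n) → edgeCount G ≡ ∑[ i < n ] ∑[ j < n ] 𝟙 (i <ᶠ j ∧ adj G i j)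
edgeCount≡∑ {n} G =
  trans (sum-map-allFin (λ i → sum (map (λ j → 𝟙 (i <ᶠ j ∧ adj G i j)) (allFin n))))
        (sum-cong-≗ {n} (λ i → sum-map-allFin (λ j → 𝟙 (i <ᶠ j ∧ adj G i j))))

𝟙-adj-split : ∀ {n} (G : Graph n) i j →
  𝟙 (adj G i j) ≡ 𝟙 (i <ᶠ j ∧ adj G i j) + 𝟙 (j <ᶠ i ∧ adj G j i)
𝟙-adj-split G i j
  with i <ᶠ j | <ᵇ-reflects-< (toℕ i) (toℕ j) | j <ᶠ i | <ᵇ-reflects-< (toℕ j) (toℕ i)
... | true  | ofʸ i<j | true  | ofʸ j<i = contradiction j<i (<⇒≯ i<j)
... | true  | _       | false | _       = sym (+-identityʳ _)
... | false | _       | true  | _       = cong 𝟙 (adj-sym G i j)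
... | false | ofⁿ i≮j | false | ofⁿ j≮i =
  cong 𝟙 (subst (λ k → adj G i k ≡ false) (toℕ-injective (≤-antisym (≮⇒≥ j≮i) (≮⇒≥ i≮j))) (adj-irrefl G i))

arcCount≡2*edgeCount : ∀ {n} (G : Graph n) → arcCount G ≡ 2 * edgeCount G
arcCount≡2*edgeCount {n} G = begin
  arcCount G
    ≡⟨ ∑∑-cong (𝟙-adj-split G) ⟩
  ∑[ i < n ] ∑[ j < n ] (𝟙 (i <ᶠ j ∧ adj G i j) + 𝟙 (j <ᶠ i ∧ adj G j i))
    ≡⟨ ∑∑-distrib-+ (λ i j → 𝟙 (i <ᶠ j ∧ adj G i j)) (λ i j → 𝟙 (j <ᶠ i ∧ adj G j i)) ⟩
  ∑[ i < n ] ∑[ j < n ] 𝟙 (i <ᶠ j ∧ adj G i j) + ∑[ i < n ] ∑[ j < n ] 𝟙 (j <ᶠ i ∧ adj G j i)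
    ≡⟨ cong (∑[ i < n ] ∑[ j < n ] 𝟙 (i <ᶠ j ∧ adj G i j) +_) (∑-comm {n} {n} (λ i j → 𝟙 (j <ᶠ i ∧ adj G j i))) ⟩
  ∑[ i < n ] ∑[ j < n ] 𝟙 (i <ᶠ j ∧ adj G i j) + ∑[ j < n ] ∑[ i < n ] 𝟙 (j <ᶠ i ∧ adj G j i)
    ≡⟨ cong₂ _+_ (sym (edgeCount≡∑ G)) (sym (edgeCount≡∑ G)) ⟩
  edgeCount G + edgeCount G
    ≡⟨ cong (edgeCount G +_) (sym (+-identityʳ _)) ⟩
  2 * edgeCount G ∎
  where open ≡-Reasoning

-- Row 0 contributes one pair for each j > 0; the remaining rows are the pairs of Fin n.
pairCount : ∀ n → ∑[ i < n ] ∑[ j < n ] 𝟙 (i <ᶠ j) ≡ n C 2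
pairCount zero    = refl
pairCount (suc n) = begin
  ∑[ j < n ] 1 + ∑[ i < n ] ∑[ j < n ] 𝟙 (i <ᶠ j) ≡⟨ cong₂ _+_ (trans (∑-one n) (sym (nC1≡n n))) (pairCount n) ⟩
  n C 1 + n C 2                                  ≡⟨ nCk+nC[k+1]≡[n+1]C[k+1] n 1 ⟩
  suc n C 2                                      ∎
  where open ≡-Reasoning

edge-or-nonedge : ∀ {n} (G : Graph n) i j →
  𝟙 (i <ᶠ j ∧ adj G i j) + 𝟙 (i <ᶠ j ∧ adj (complement G) i j) ≡ 𝟙 (i <ᶠ j)
edge-or-nonedge G i j with i <ᶠ j | <ᵇ-reflects-< (toℕ i) (toℕ j)
... | false | _       = refl
... | true  | ofʸ i<j with i ≟ j | adj G i j
...   | yes refl | _     = contradiction i<j (<-irrefl refl)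
...   | no _     | true  = refl
...   | no _     | false = refl

edgeCount+edgeCount-complement : ∀ {n} (G : Graph n) → edgeCount G + edgeCount (complement G) ≡ n C 2
edgeCount+edgeCount-complement {n} G = begin
  edgeCount G + edgeCount (complement G)
    ≡⟨ cong₂ _+_ (edgeCount≡∑ G) (edgeCount≡∑ (complement G)) ⟩
  ∑[ i < n ] ∑[ j < n ] 𝟙 (i <ᶠ j ∧ adj G i j) + ∑[ i < n ] ∑[ j < n ] 𝟙 (i <ᶠ j ∧ adj (complement G) i j)
    ≡⟨ sym (∑∑-distrib-+ (λ i j → 𝟙 (i <ᶠ j ∧ adj G i j)) (λ i j → 𝟙 (i <ᶠ j ∧ adj (complement G) i j))) ⟩
  ∑[ i < n ] ∑[ j < n ] (𝟙 (i <ᶠ j ∧ adj G i j) + 𝟙 (i <ᶠ j ∧ adj (complement G) i j))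
    ≡⟨ ∑∑-cong (edge-or-nonedge G) ⟩
  ∑[ i < n ] ∑[ j < n ] 𝟙 (i <ᶠ j)
    ≡⟨ pairCount n ⟩
  n C 2 ∎
  where open ≡-Reasoning

ManyEdges⇔complement+5≤n : ∀ {n} (G : Graph n) → ManyEdges G ⇔ edgeCount (complement G) + 5 ≤ n
ManyEdges⇔complement+5≤n {n} G = mk⇔
  (λ many → +-cancelˡ-≤ E _ _ (subst (_≤ E + n) (sym total) many))
  (λ few → subst (_≤ E + n) total (+-monoʳ-≤ E few))
  where
  E : ℕ
  E = edgeCount G
  total : E + (edgeCount (complement G) + 5) ≡ n C 2 + 5
  total = trans (sym (+-assoc E _ 5)) (cong (_+ 5) (edgeCount+edgeCount-complement G))

arcCount-cong : ∀ {n} (G G′ : Graph n) → (∀ i j → adj G i j ≡ adj G′ i j) → arcCount G ≡ arcCount G′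
arcCount-cong G G′ G≡G′ = ∑∑-cong (λ i j → cong 𝟙 (G≡G′ i j))

arcCount-disjoint : ∀ {k m n} (G : Graph n) (e : (Fin k ⊎ Fin m) ↔ Fin n) →
  (∀ i j → adj G (to e (inj₁ i)) (to e (inj₂ j)) ≡ false) →
  arcCount G ≡ arcCount (pullback G (to e ∘ inj₁)) + arcCount (pullback G (to e ∘ inj₂))
arcCount-disjoint {k} {m} {n} G e no-cross = begin
  arcCount G
    ≡⟨ sum-cong-≗ (λ u → ∑-↔⊎ e (𝟙 ∘ adj G u)) ⟩
  ∑[ u < n ] (row₁ u + row₂ u)
    ≡⟨ ∑-↔⊎ e (λ u → row₁ u + row₂ u) ⟩
  ∑[ i < k ] (row₁ (e₁ i) + row₂ (e₁ i)) + ∑[ j < m ] (row₁ (e₂ j) + row₂ (e₂ j))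
    ≡⟨ cong₂ _+_ (sum-cong-≗ (λ i → trans (cong (row₁ (e₁ i) +_) (∑-zero (cong 𝟙 ∘ no-cross i)))
                                           (+-identityʳ _)))
                 (sum-cong-≗ (λ j → cong (_+ row₂ (e₂ j))
                                         (∑-zero (λ i → cong 𝟙 (trans (adj-sym G _ _) (no-cross i j)))))) ⟩
  arcCount (pullback G e₁) + arcCount (pullback G e₂) ∎
  where
  open ≡-Reasoning
  e₁ : Fin k → Fin n
  e₁ = to e ∘ inj₁
  e₂ : Fin m → Fin n
  e₂ = to e ∘ inj₂
  row₁ row₂ : Fin n → ℕ
  row₁ u = ∑[ i < k ] 𝟙 (adj G u (e₁ i))
  row₂ u = ∑[ j < m ] 𝟙 (adj G u (e₂ j))

-- Orientations of diameter two

-- For V = Fin n these are definitionally IsOrientation and DiameterTwo.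
IsOrientationOf : {V : Set} → (V → V → Bool) → (V → V → Bool) → Set
IsOrientationOf A D =
  (∀ u v → D u v ≡ true → A u v ≡ true) ×
  (∀ u v → A u v ≡ true → D u v ≡ true ⊎ D v u ≡ true) ×
  (∀ u v → D u v ≡ true → D v u ≡ false)

TwoStep : {V : Set} → (V → V → Bool) → V → V → Set
TwoStep D u v = D u v ≡ true ⊎ ∃[ w ] (D u w ≡ true × D w v ≡ true)

HasDiam2OrientationOf : {V : Set} → (V → V → Bool) → Set
HasDiam2OrientationOf {V} A =
  Σ[ D ∈ (V → V → Bool) ] IsOrientationOf A D × (∀ p q → p ≢ q → TwoStep D p q)

HasDiam2Orientation-↔ : ∀ {n} {V : Set} (G : Graph n) (e : V ↔ Fin n) {A : V → V → Bool} →
  (∀ p q → adj G (to e p) (to e q) ≡ A p q) → HasDiam2OrientationOf A → HasDiam2Orientation G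
HasDiam2Orientation-↔ {n} G e {A} G≡A (D , (arcs , covers , antisym) , two-step) =
  D′ , (arcs′ , covers′ , λ u v → antisym (from e u) (from e v)) , two-step′
  where
  D′ : Fin n → Fin n → Bool
  D′ u v = D (from e u) (from e v)

  adj-from : ∀ u v → adj G u v ≡ A (from e u) (from e v)
  adj-from u v = trans (sym (cong₂ (adj G) (Inverse.strictlyInverseˡ e u) (Inverse.strictlyInverseˡ e v)))
                       (G≡A (from e u) (from e v))

  arcs′ : ∀ u v → D′ u v ≡ true → adj G u v ≡ true
  arcs′ u v d = trans (adj-from u v) (arcs _ _ d)

  covers′ : ∀ u v → adj G u v ≡ true → D′ u v ≡ true ⊎ D′ v u ≡ true
  covers′ u v a = covers _ _ (trans (sym (adj-from u v)) a)

  two-step′ : DiameterTwo D′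
  two-step′ u v u≢v with two-step (from e u) (from e v) (u≢v ∘ Injection.injective (↔⇒↣ (↔-sym e)))
  ... | inj₁ d             = inj₁ d
  ... | inj₂ (w , d₁ , d₂) =
    inj₂ (to e w , subst (λ w′ → D _ w′ ≡ true) (sym (Inverse.strictlyInverseʳ e w)) d₁
                 , subst (λ w′ → D w′ _ ≡ true) (sym (Inverse.strictlyInverseʳ e w)) d₂)

_⊕_ : {U W : Set} → (U → U → Bool) → (W → W → Bool) → U ⊎ W → U ⊎ W → Bool
(A ⊕ B) (inj₁ u) (inj₁ u′) = A u u′
(A ⊕ B) (inj₂ w) (inj₂ w′) = B w w′
(A ⊕ B) _        _         = true

joinOrientation : {U W : Set} → (U → U → Bool) → (W → W → Bool) → (U → W → Bool) →
                  U ⊎ W → U ⊎ W → Bool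
joinOrientation D E σ (inj₁ u) (inj₁ u′) = D u u′
joinOrientation D E σ (inj₁ u) (inj₂ w)  = σ u w
joinOrientation D E σ (inj₂ w) (inj₁ u)  = not (σ u w)
joinOrientation D E σ (inj₂ w) (inj₂ w′) = E w w′

joinOrientation-IsOrientationOf : {U W : Set} {A D : U → U → Bool} {B E : W → W → Bool} →
  IsOrientationOf A D → IsOrientationOf B E → (σ : U → W → Bool) →
  IsOrientationOf (A ⊕ B) (joinOrientation D E σ)
joinOrientation-IsOrientationOf {U} {W} {A} {D} {B} {E} (arcsD , coversD , antiD) (arcsE , coversE , antiE) σ =
  arcs , covers , anti
  where
  O : U ⊎ W → U ⊎ W → Bool
  O = joinOrientation D E σ

  arcs : ∀ p q → O p q ≡ true → (A ⊕ B) p q ≡ true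
  arcs (inj₁ u) (inj₁ u′) = arcsD u u′
  arcs (inj₁ u) (inj₂ w)  = λ _ → refl
  arcs (inj₂ w) (inj₁ u)  = λ _ → refl
  arcs (inj₂ w) (inj₂ w′) = arcsE w w′

  covers : ∀ p q → (A ⊕ B) p q ≡ true → O p q ≡ true ⊎ O q p ≡ true
  covers (inj₁ u) (inj₁ u′) = coversD u u′
  covers (inj₁ u) (inj₂ w)  _ with σ u w
  ... | true  = inj₁ refl
  ... | false = inj₂ refl
  covers (inj₂ w) (inj₁ u)  _ with σ u w
  ... | true  = inj₂ refl
  ... | false = inj₁ refl
  covers (inj₂ w) (inj₂ w′) = coversE w w′

  anti : ∀ p q → O p q ≡ true → O q p ≡ false
  anti (inj₁ u) (inj₁ u′) = antiD u u′
  anti (inj₁ u) (inj₂ w)  = cong not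
  anti (inj₂ w) (inj₁ u)  = trans (sym (not-involutive _)) ∘ cong not
  anti (inj₂ w) (inj₂ w′) = antiE w w′

-- The join of the pentagram with a graph of diameter-two orientation

pentagramArc : Fin 5 → Fin 5 → Bool
pentagramArc 0F 2F = true
pentagramArc 0F 3F = true
pentagramArc 1F 4F = true
pentagramArc 2F 4F = true
pentagramArc 3F 1F = true
pentagramArc _  _  = false

pentagramArc-orients : IsOrientationOf (adj (complement C₅)) pentagramArc
pentagramArc-orients = from-yes
  ((all? λ u → all? λ v → (pentagramArc u v ≟ᵇ true) →-dec (adj (complement C₅) u v ≟ᵇ true)) ×-dec
   (all? λ u → all? λ v → (adj (complement C₅) u v ≟ᵇ true) →-dec
                          ((pentagramArc u v ≟ᵇ true) ⊎-dec (pentagramArc v u ≟ᵇ true))) ×-dec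
   (all? λ u → all? λ v → (pentagramArc u v ≟ᵇ true) →-dec (pentagramArc v u ≟ᵇ false)))

-- The vertices of H are classified relative to a fixed vertex x: x itself, the out-neighbours
-- of x, and the rest. cycleToClass i c says that the cycle vertex i points to every vertex of
-- class c; otherwise every vertex of class c points to i.
data Class : Set where
  X A Z : Class

cycleToClass : Fin 5 → Class → Bool
cycleToClass 1F X = true
cycleToClass 1F Z = true
cycleToClass 2F A = true
cycleToClass 2F Z = true
cycleToClass 3F X = true
cycleToClass 4F X = true
cycleToClass 4F A = true
cycleToClass _  _ = false

module PentagramJoin {m} (H : Graph m) (D : Fin m → Fin m → Bool) (D-orients : IsOrientation H D)
                     (D-diam : DiameterTwo D) (x y : Fin m) (x≢y : x ≢ y) where

  D-irrefl : ∀ v → D v v ≡ false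
  D-irrefl v with D v v in v→v
  ... | true  = trans (sym (proj₁ D-orients v v v→v)) (adj-irrefl H v)
  ... | false = refl

  D-antisym : ∀ u v → D u v ≡ true → D v u ≡ false
  D-antisym = proj₂ (proj₂ D-orients)

  classOf : ∀ {w} → Dec (w ≡ x) → Bool → Class
  classOf (yes _) _     = X
  classOf (no _)  true  = A
  classOf (no _)  false = Z

  class : Fin m → Class
  class w = classOf (w ≟ x) (D x w)

  data ClassView (w : Fin m) : Set where
    is-x     : w ≡ x → class w ≡ X → ClassView w
    out-of-x : D x w ≡ true → class w ≡ A → ClassView w
    other    : w ≢ x → D x w ≡ false → class w ≡ Z → ClassView w

  classify : ∀ w → ClassView w
  classify w with w ≟ x in d | D x w in b
  ... | yes w≡x | _     = is-x w≡x (cong₂ classOf d b)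
  ... | no _    | true  = out-of-x b (cong₂ classOf d b)
  ... | no w≢x  | false = other w≢x b (cong₂ classOf d b)

  class-x : class x ≡ X
  class-x with classify x
  ... | is-x _ cx       = cx
  ... | out-of-x x→x _  = contradiction (trans (sym x→x) (D-irrefl x)) λ ()
  ... | other x≢x _ _   = contradiction refl x≢x

  class-A : ∀ {a} → D x a ≡ true → class a ≡ A
  class-A {a} x→a with classify a
  ... | is-x refl _    = contradiction (trans (sym x→a) (D-irrefl x)) λ ()
  ... | out-of-x _ ca  = ca
  ... | other _ x↛a _  = contradiction (trans (sym x→a) x↛a) λ ()

  A-into-Z : ∀ {z} → z ≢ x → D x z ≡ false → ∃[ a ] (D x a ≡ true × D a z ≡ true)
  A-into-Z {z} z≢x x↛z with D-diam x z (z≢x ∘ sym)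
  ... | inj₁ x→z = contradiction (trans (sym x→z) x↛z) λ ()
  ... | inj₂ path = path

  outside-X∪A : ∃[ z ] (z ≢ x × D x z ≡ false)
  outside-X∪A with D-diam y x (x≢y ∘ sym)
  ... | inj₁ y→x           = y , x≢y ∘ sym , D-antisym y x y→x
  ... | inj₂ (w , _ , w→x) = w , w≢x , D-antisym w x w→x
    where
    w≢x : w ≢ x
    w≢x refl = contradiction (trans (sym w→x) (D-irrefl x)) λ ()

  class-Z : ∀ {z} → z ≢ x → D x z ≡ false → class z ≡ Z
  class-Z {z} z≢x x↛z with classify z
  ... | is-x z≡x _      = contradiction z≡x z≢x
  ... | out-of-x x→z _  = contradiction (trans (sym x→z) x↛z) λ ()
  ... | other _ _ cz    = cz

  z₀ : Fin m
  z₀ = proj₁ outside-X∪A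

  z₀≢x : z₀ ≢ x
  z₀≢x = proj₁ (proj₂ outside-X∪A)

  x↛z₀ : D x z₀ ≡ false
  x↛z₀ = proj₂ (proj₂ outside-X∪A)

  a₀ : Fin m
  a₀ = proj₁ (A-into-Z z₀≢x x↛z₀)

  x→a₀ : D x a₀ ≡ true
  x→a₀ = proj₁ (proj₂ (A-into-Z z₀≢x x↛z₀))

  O : Fin 5 ⊎ Fin m → Fin 5 ⊎ Fin m → Bool
  O = joinOrientation pentagramArc D (λ i w → cycleToClass i (class w))

  toward : ∀ i {w c} → class w ≡ c → cycleToClass i c ≡ true → O (inj₁ i) (inj₂ w) ≡ true
  toward i cw arc = trans (cong (cycleToClass i) cw) arc

  away : ∀ i {w c} → class w ≡ c → cycleToClass i c ≡ false → O (inj₂ w) (inj₁ i) ≡ true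
  away i cw no-arc = cong not (trans (cong (cycleToClass i) cw) no-arc)

  via : ∀ {i j} w {c} → class w ≡ c → cycleToClass i c ≡ true → cycleToClass j c ≡ false →
        TwoStep O (inj₁ i) (inj₁ j)
  via {i} {j} w cw arc no-arc = inj₂ (inj₂ w , toward i cw arc , away j cw no-arc)

  cycle→cycle : ∀ i j → i ≢ j → TwoStep O (inj₁ i) (inj₁ j)
  cycle→cycle 0F 1F _ = inj₂ (inj₁ 3F , refl , refl)
  cycle→cycle 0F 2F _ = inj₁ refl
  cycle→cycle 0F 3F _ = inj₁ refl
  cycle→cycle 0F 4F _ = inj₂ (inj₁ 2F , refl , refl)
  cycle→cycle 1F 0F _ = via x  class-x  refl refl
  cycle→cycle 1F 2F _ = via x  class-x  refl refl
  cycle→cycle 1F 3F _ = via z₀ (class-Z z₀≢x x↛z₀) refl refl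
  cycle→cycle 1F 4F _ = inj₁ refl
  cycle→cycle 2F 0F _ = via a₀ (class-A x→a₀) refl refl
  cycle→cycle 2F 1F _ = via a₀ (class-A x→a₀) refl refl
  cycle→cycle 2F 3F _ = via a₀ (class-A x→a₀) refl refl
  cycle→cycle 2F 4F _ = inj₁ refl
  cycle→cycle 3F 0F _ = via x  class-x  refl refl
  cycle→cycle 3F 1F _ = inj₁ refl
  cycle→cycle 3F 2F _ = via x  class-x  refl refl
  cycle→cycle 3F 4F _ = inj₂ (inj₁ 1F , refl , refl)
  cycle→cycle 4F 0F _ = via x  class-x  refl refl
  cycle→cycle 4F 1F _ = via a₀ (class-A x→a₀) refl refl
  cycle→cycle 4F 2F _ = via x  class-x  refl refl
  cycle→cycle 4F 3F _ = via a₀ (class-A x→a₀) refl refl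
  cycle→cycle 0F 0F i≢i = contradiction refl i≢i
  cycle→cycle 1F 1F i≢i = contradiction refl i≢i
  cycle→cycle 2F 2F i≢i = contradiction refl i≢i
  cycle→cycle 3F 3F i≢i = contradiction refl i≢i
  cycle→cycle 4F 4F i≢i = contradiction refl i≢i

  cycle→x : ∀ i → TwoStep O (inj₁ i) (inj₂ x)
  cycle→x 0F = inj₂ (inj₁ 3F , refl , toward 3F class-x refl)
  cycle→x 1F = inj₁ (toward 1F class-x refl)
  cycle→x 2F = inj₂ (inj₁ 4F , refl , toward 4F class-x refl)
  cycle→x 3F = inj₁ (toward 3F class-x refl)
  cycle→x 4F = inj₁ (toward 4F class-x refl)

  cycle→A : ∀ i {a} → D x a ≡ true → TwoStep O (inj₁ i) (inj₂ a)
  cycle→A 0F x→a = inj₂ (inj₁ 2F , refl , toward 2F (class-A x→a) refl)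
  cycle→A 1F x→a = inj₂ (inj₁ 4F , refl , toward 4F (class-A x→a) refl)
  cycle→A 2F x→a = inj₁ (toward 2F (class-A x→a) refl)
  cycle→A 3F x→a = inj₂ (inj₂ x , toward 3F class-x refl , x→a)
  cycle→A 4F x→a = inj₁ (toward 4F (class-A x→a) refl)

  cycle→Z : ∀ i {z} → class z ≡ Z → ∃[ a ] (D x a ≡ true × D a z ≡ true) → TwoStep O (inj₁ i) (inj₂ z)
  cycle→Z 0F cz _                 = inj₂ (inj₁ 2F , refl , toward 2F cz refl)
  cycle→Z 1F cz _                 = inj₁ (toward 1F cz refl)
  cycle→Z 2F cz _                 = inj₁ (toward 2F cz refl)
  cycle→Z 3F cz _                 = inj₂ (inj₁ 1F , refl , toward 1F cz refl)
  cycle→Z 4F cz (a , x→a , a→z) = inj₂ (inj₂ a , toward 4F (class-A x→a) refl , a→z)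

  x→cycle : ∀ i → TwoStep O (inj₂ x) (inj₁ i)
  x→cycle 0F = inj₁ (away 0F class-x refl)
  x→cycle 1F = inj₂ (inj₂ a₀ , x→a₀ , away 1F (class-A x→a₀) refl)
  x→cycle 2F = inj₁ (away 2F class-x refl)
  x→cycle 3F = inj₂ (inj₁ 0F , away 0F class-x refl , refl)
  x→cycle 4F = inj₂ (inj₁ 2F , away 2F class-x refl , refl)

  A→cycle : ∀ i {a} → class a ≡ A → TwoStep O (inj₂ a) (inj₁ i)
  A→cycle 0F ca = inj₁ (away 0F ca refl)
  A→cycle 1F ca = inj₁ (away 1F ca refl)
  A→cycle 2F ca = inj₂ (inj₁ 0F , away 0F ca refl , refl)
  A→cycle 3F ca = inj₁ (away 3F ca refl)
  A→cycle 4F ca = inj₂ (inj₁ 1F , away 1F ca refl , refl)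

  Z→cycle : ∀ i {z} → class z ≡ Z → TwoStep O (inj₂ z) (inj₁ i)
  Z→cycle 0F cz = inj₁ (away 0F cz refl)
  Z→cycle 1F cz = inj₂ (inj₁ 3F , away 3F cz refl , refl)
  Z→cycle 2F cz = inj₂ (inj₁ 0F , away 0F cz refl , refl)
  Z→cycle 3F cz = inj₁ (away 3F cz refl)
  Z→cycle 4F cz = inj₁ (away 4F cz refl)

  O-two-step : ∀ p q → p ≢ q → TwoStep O p q
  O-two-step (inj₁ i) (inj₁ j) p≢q = cycle→cycle i j (p≢q ∘ cong inj₁)
  O-two-step (inj₁ i) (inj₂ w) _ with classify w
  ... | is-x refl _       = cycle→x i
  ... | out-of-x x→w _    = cycle→A i x→w
  ... | other w≢x x↛w cw = cycle→Z i cw (A-into-Z w≢x x↛w)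
  O-two-step (inj₂ w) (inj₁ i) _ with classify w
  ... | is-x refl _   = x→cycle i
  ... | out-of-x _ cw = A→cycle i cw
  ... | other _ _ cw  = Z→cycle i cw
  O-two-step (inj₂ v) (inj₂ w) p≢q with D-diam v w (p≢q ∘ cong inj₂)
  ... | inj₁ v→w             = inj₁ v→w
  ... | inj₂ (u , v→u , u→w) = inj₂ (inj₂ u , v→u , u→w)

pentagram-join-orientation : ∀ {m} (H : Graph m) → 2 ≤ m → HasDiam2Orientation H →
  HasDiam2OrientationOf (adj (complement C₅) ⊕ adj H)
pentagram-join-orientation H (s≤s (s≤s _)) (D , D-orients , D-diam) =
  O , joinOrientation-IsOrientationOf pentagramArc-orients D-orients _ , O-two-step
  where open PentagramJoin H D D-orients D-diam zero (suc zero) (λ ())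

-- A 5-cycle component of the complement

module C5Component {n} (G : Graph n) (f : Fin 5 → Fin n)
  (f-inj : ∀ i j → f i ≡ f j → i ≡ j)
  (f-cycle : ∀ i j → adj (complement G) (f i) (f j) ≡ c5adj i j)
  (f-closed : ∀ i v → (∀ j → v ≢ f j) → adj (complement G) (f i) v ≡ false) where

  f-injective : Injective _≡_ _≡_ f
  f-injective = f-inj _ _

  m : ℕ
  m = proj₁ (extend-injection-⊎ f f-injective)

  e : (Fin 5 ⊎ Fin m) ↔ Fin n
  e = proj₁ (proj₂ (extend-injection-⊎ f f-injective))

  e-inj₁ : ∀ i → to e (inj₁ i) ≡ f i
  e-inj₁ = proj₂ (proj₂ (extend-injection-⊎ f f-injective))

  g : Fin m → Fin n
  g = to e ∘ inj₂

  H : Graph m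
  H = pullback G g

  5+m≡n : 5 + m ≡ n
  5+m≡n = ↔⇒≡ (e ↔-∘ +↔⊎)

  e-injective : Injective _≡_ _≡_ (to e)
  e-injective = Injection.injective (↔⇒↣ e)

  g-injective : Injective _≡_ _≡_ g
  g-injective = inj₂-injective ∘ e-injective

  g≢f : ∀ j i → g j ≢ f i
  g≢f j i gj≡fi with e-injective {inj₂ j} {inj₁ i} (trans gj≡fi (sym (e-inj₁ i)))
  ... | ()

  f-g-adjacent : ∀ i j → adj G (f i) (g j) ≡ true
  f-g-adjacent i j with f i ≟ g j | adj G (f i) (g j) | f-closed i (g j) (g≢f j)
  ... | yes fi≡gj | _     | _  = contradiction (sym fi≡gj) (g≢f j i)
  ... | no _      | true  | _  = refl
  ... | no _      | false | ()

  cycle-adjacency : ∀ i j → adj G (f i) (f j) ≡ adj (complement C₅) i j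
  cycle-adjacency i j = begin
    adj G (f i) (f j)                                  ≡⟨ sym (complement-involutive (pullback G f) i j) ⟩
    adj (complement (complement (pullback G f))) i j   ≡⟨ cong (λ b → not b ∧ not ⌊ i ≟ j ⌋) C̄≡C₅ ⟩
    adj (complement C₅) i j                            ∎
    where
    open ≡-Reasoning
    C̄≡C₅ : adj (complement (pullback G f)) i j ≡ c5adj i j
    C̄≡C₅ = trans (complement-pullback G f-injective i j) (f-cycle i j)

  join-adjacency : ∀ p q → adj G (to e p) (to e q) ≡ (adj (complement C₅) ⊕ adj H) p q
  join-adjacency (inj₁ i) (inj₁ j) = trans (cong₂ (adj G) (e-inj₁ i) (e-inj₁ j)) (cycle-adjacency i j)
  join-adjacency (inj₁ i) (inj₂ j) = trans (cong (λ u → adj G u (g j)) (e-inj₁ i)) (f-g-adjacent i j)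
  join-adjacency (inj₂ j) (inj₁ i) =
    trans (adj-sym G _ _) (trans (cong (λ u → adj G u (g j)) (e-inj₁ i)) (f-g-adjacent i j))
  join-adjacency (inj₂ j) (inj₂ j′) = refl

  arcCount-complement : arcCount (complement G) ≡ 10 + arcCount (complement H)
  arcCount-complement = begin
    arcCount (complement G)
      ≡⟨ arcCount-disjoint (complement G) e no-cross ⟩
    arcCount (pullback (complement G) (to e ∘ inj₁)) + arcCount (pullback (complement G) g)
      ≡⟨ cong₂ _+_ (arcCount-cong (pullback (complement G) (to e ∘ inj₁)) C₅ on-cycle)
                   (arcCount-cong (pullback (complement G) g) (complement H)
                                  (λ i j → sym (complement-pullback G g-injective i j))) ⟩
    arcCount C₅ + arcCount (complement H) ∎
    where
    open ≡-Reasoning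
    no-cross : ∀ i j → adj (complement G) (to e (inj₁ i)) (g j) ≡ false
    no-cross i j = trans (cong (λ u → adj (complement G) u (g j)) (e-inj₁ i)) (f-closed i (g j) (g≢f j))
    on-cycle : ∀ i j → adj (complement G) (to e (inj₁ i)) (to e (inj₁ j)) ≡ c5adj i j
    on-cycle i j = trans (cong₂ (adj (complement G)) (e-inj₁ i) (e-inj₁ j)) (f-cycle i j)

  edgeCount-complement : edgeCount (complement G) ≡ 5 + edgeCount (complement H)
  edgeCount-complement = *-cancelˡ-≡ _ _ 2 (begin
    2 * edgeCount (complement G)        ≡⟨ sym (arcCount≡2*edgeCount (complement G)) ⟩
    arcCount (complement G)             ≡⟨ arcCount-complement ⟩
    10 + arcCount (complement H)        ≡⟨ cong (10 +_) (arcCount≡2*edgeCount (complement H)) ⟩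
    10 + 2 * edgeCount (complement H)   ≡⟨ sym (*-distribˡ-+ 2 5 _) ⟩
    2 * (5 + edgeCount (complement H))  ∎)
    where open ≡-Reasoning

  H-few-nonedges : ManyEdges G → edgeCount (complement H) + 5 ≤ m
  H-few-nonedges many = +-cancelˡ-≤ 5 _ _ (subst₂ _≤_ shift (sym 5+m≡n) (Equivalence.to (ManyEdges⇔complement+5≤n G) many))
    where
    shift : edgeCount (complement G) + 5 ≡ 5 + (edgeCount (complement H) + 5)
    shift = trans (cong (_+ 5) edgeCount-complement) (+-assoc 5 _ 5)

  HasDiam2Orientation-from-H : 2 ≤ m → HasDiam2Orientation H → HasDiam2Orientation G
  HasDiam2Orientation-from-H 2≤m = HasDiam2Orientation-↔ G e join-adjacency ∘ pentagram-join-orientation H 2≤m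

lemma18 : ∀ {n} (G : Graph n) → MinimalCounterexample G → ¬ HasC5Component (complement G)
lemma18 {n} G ((_ , many , no-orientation) , minimal-order , _) (f , f-inj , f-cycle , f-closed) =
  minimal-order m m<n H (5≤m , Equivalence.from (ManyEdges⇔complement+5≤n H) few , no-orientation ∘ HasDiam2Orientation-from-H 2≤m)
  where
  open C5Component G f f-inj f-cycle f-closed
  few : edgeCount (complement H) + 5 ≤ m
  few = H-few-nonedges many
  5≤m : 5 ≤ m
  5≤m = ≤-trans (m≤n+m 5 _) few
  2≤m : 2 ≤ m
  2≤m = ≤-trans (s≤s (s≤s z≤n)) 5≤m
  m<n : m < n
  m<n = subst (m <_) 5+m≡n (m<n+m m (s≤s z≤n))
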